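{- If $\lambda$ is a nonempty partition, then its $x$-ray list $\lambda_x$ is of the form $(1,2,3,\dots,n,a_1,a_2,\dots,a_r)$ for some $n\ge1$, $r\ge0$, with $n\ge a_1\ge a_2\ge\cdots\ge a_r$.
   Context: For a partition $\lambda$ with $\ell(\lambda)$ parts, let $m=\max\{\lambda_1,\ell(\lambda)\}$ and let the Ferrers matrix of $\lambda$ be the $m\times m$ $0/1$ matrix whose $(i,j)$ entry is $1$ if $(i,j)$ is a cell of the Young diagram of $\lambda$ (i.e. $j\le\lambda_i$) and $0$ otherwise. The $x$-ray list $\lambda_x$ is the sequence $(s_2,s_3,\dots,s_{2m})$ where $s_k$ is the sum of the entries $(i,j)$ of the Ferrers matrix with $i+j=k$ (the anti-diagonal sums, in order). -}

module Defs where

open import Data.Nat using (ℕ; zero; suc; _+_; _∸_; _≤_; _≥_; _<_; _⊔_; _≤ᵇ_)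
open import Data.Bool using (Bool; true; false; if_then_else_)
open import Data.List using (List; []; _∷_; length; map)
open import Data.Nat.ListAction using (sum)
open import Data.List.Relation.Unary.All using (All)
open import Data.List.Relation.Unary.Linked using (Linked)

IsPartition : List ℕ → Set
IsPartition λs = Linked _≥_ λs × All (λ p → 1 ≤ p) λs
  where open import Data.Product using (_×_)

-- i-th part (1-indexed); 0 beyond the length.
part : List ℕ → ℕ → ℕ
part []       _             = 0
part (x ∷ xs) zero          = 0
part (x ∷ xs) (suc zero)    = x
part (x ∷ xs) (suc (suc i)) = part xs (suc i)

firstPart : List ℕ → ℕ
firstPart []      = 0
firstPart (x ∷ _) = x

sideLength : List ℕ → ℕ
sideLength λs = firstPart λs ⊔ length λs

ferrers : List ℕ → ℕ → ℕ → ℕ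
ferrers λs i zero    = 0
ferrers λs i (suc j) = if suc j ≤ᵇ part λs i then 1 else 0

range : ℕ → ℕ → List ℕ
range a zero      = []
range a (suc len) = a ∷ range (suc a) len

-- anti-diagonal sum s_k = Σ_{1≤i≤m, 1≤k-i≤m} F(i, k-i)
antiDiagSum : List ℕ → ℕ → ℕ
antiDiagSum λs k =
  sum (map (λ i → if ((k ∸ i) ≤ᵇ m) then (if (suc i ≤ᵇ k) then ferrers λs i (k ∸ i) else 0) else 0)
           (range 1 m))
  where m = sideLength λs

-- x-ray list (s_2, s_3, …, s_{2m})
xray : List ℕ → List ℕ
xray λs = map (antiDiagSum λs) (range 2 (sideLength λs + sideLength λs ∸ 1))

-- Row r of the Ferrers diagram meets the anti-diagonal i + j = k exactly when
-- r < k ≤ λ_r + r, so s_k counts such rows. Put n + 1 = min_r (λ_r + r) ≥ 2.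
-- For k ≤ n + 1 every row r < k meets anti-diagonal k, so s_k = k - 1.
-- For k > n, a row i attaining the minimum ends at or before anti-diagonal k, and
-- λ_{r+1} + (r+1) ≤ (λ_r + r) + 1 because λ is weakly decreasing; so the rows
-- meeting anti-diagonal k + 1 other than i, with those below i moved up by one,
-- are distinct rows meeting anti-diagonal k, and s_{k+1} ≤ s_k.
module Submission where

open import Defs
open import Data.Nat using (ℕ; zero; suc; _+_; _∸_; _≤_; _≥_; _<_; z≤n; s≤s; s≤s⁻¹)
open import Data.Nat.Properties
open import Data.Nat.ListAction using (sum)
open import Data.Bool using (if_then_else_)
open import Data.List using (List; []; _∷_; _++_; map)
open import Data.List.Properties using (map-++; map-cong)
open import Data.List.Relation.Unary.All using (All; []; _∷_)
open import Data.List.Relation.Unary.Linked as Linked using (Linked; []; [-]; _∷_)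
open import Data.Product using (Σ; ∃-syntax; _×_; _,_; proj₁; proj₂)
open import Data.Sum using (inj₁; inj₂; [_,_]′)
open import Function using (_∘_)
open import Relation.Nullary using (Dec; yes; no; does; ¬_; contradiction)
open import Relation.Nullary.Decidable using (_×-dec_)
open import Relation.Binary.PropositionalEquality
  using (_≡_; _≢_; refl; sym; trans; cong; cong₂; subst; module ≡-Reasoning)

m∸n≤o⇒m≤o+n : ∀ m n {o} → m ∸ n ≤ o → m ≤ o + n
m∸n≤o⇒m≤o+n m n {o} le =
  ≤-trans (m≤n+m∸n m n) (subst (n + (m ∸ n) ≤_) (+-comm n o) (+-monoʳ-≤ n le))

m≤o+n⇒m∸n≤o : ∀ m n {o} → m ≤ o + n → m ∸ n ≤ o
m≤o+n⇒m∸n≤o m n {o} le = m≤n+o⇒m∸n≤o m n (subst (m ≤_) (+-comm o n) le)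

m≤m+m∸1 : ∀ {m} → 1 ≤ m → m ≤ m + m ∸ 1
m≤m+m∸1 {m} 1≤m = m+n≤o⇒m≤o∸n m (+-monoʳ-≤ m 1≤m)

indicator : ∀ {P : Set} → Dec P → ℕ
indicator p = if does p then 1 else 0

indicator-mono : ∀ {P Q : Set} (p : Dec P) (q : Dec Q) → (P → Q) → indicator p ≤ indicator q
indicator-mono (no _)  _       _   = z≤n
indicator-mono (yes _) (yes _) _   = ≤-refl
indicator-mono (yes x) (no ¬y) P→Q = contradiction (P→Q x) ¬y

indicator-cong : ∀ {P Q : Set} (p : Dec P) (q : Dec Q) →
  (P → Q) → (Q → P) → indicator p ≡ indicator q
indicator-cong p q P→Q Q→P = ≤-antisym (indicator-mono p q P→Q) (indicator-mono q p Q→P)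

indicator-yes : ∀ {P : Set} (p : Dec P) → P → indicator p ≡ 1
indicator-yes (yes _) _ = refl
indicator-yes (no ¬x) x = contradiction x ¬x

indicator-no : ∀ {P : Set} (p : Dec P) → ¬ P → indicator p ≡ 0
indicator-no (no _)  _  = refl
indicator-no (yes x) ¬x = contradiction x ¬x

range-++ : ∀ a p q → range a (p + q) ≡ range a p ++ range (a + p) q
range-++ a zero    q rewrite +-identityʳ a = refl
range-++ a (suc p) q rewrite +-suc a p = cong (a ∷_) (range-++ (suc a) p q)

sumRange : (ℕ → ℕ) → ℕ → ℕ → ℕ
sumRange g a l = sum (map g (range a l))

sumRange-≤-suc : ∀ g a l → sumRange g a l ≤ sumRange g a (suc l)
sumRange-≤-suc g a zero    = z≤n
sumRange-≤-suc g a (suc l) = +-monoʳ-≤ (g a) (sumRange-≤-suc g (suc a) l)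

sumRange-shift-≤ : ∀ {f g : ℕ → ℕ} {a} → (∀ r → a ≤ r → f (suc r) ≤ g r) →
  ∀ l → sumRange f (suc a) l ≤ sumRange g a l
sumRange-shift-≤ step zero    = z≤n
sumRange-shift-≤ step (suc l) =
  +-mono-≤ (step _ ≤-refl) (sumRange-shift-≤ (λ r → step r ∘ ≤-trans (n≤1+n _)) l)

sumRange-skip-≤ : ∀ {f g : ℕ → ℕ} i → (∀ r → r < i → f r ≤ g r) → f i ≡ 0 →
  (∀ r → i ≤ r → f (suc r) ≤ g r) → ∀ {a} l → a ≤ i → sumRange f a l ≤ sumRange g a l
sumRange-skip-≤ i before at after zero    _   = z≤n
sumRange-skip-≤ {f} {g} i before at after {a} (suc l) a≤i with m≤n⇒m<n∨m≡n a≤i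
... | inj₁ a<i = +-mono-≤ (before a a<i) (sumRange-skip-≤ i before at after l a<i)
... | inj₂ refl = begin
  f a + sumRange f (suc a) l  ≡⟨ cong (_+ sumRange f (suc a) l) at ⟩
  sumRange f (suc a) l        ≤⟨ sumRange-shift-≤ after l ⟩
  sumRange g a l              ≤⟨ sumRange-≤-suc g a l ⟩
  sumRange g a (suc l)        ∎
  where open ≤-Reasoning

sumRange-threshold : ∀ {g : ℕ → ℕ} c a l → c ≤ a + l →
  (∀ r → a ≤ r → r < c → g r ≡ 1) → (∀ r → c ≤ r → g r ≡ 0) → sumRange g a l ≡ c ∸ a
sumRange-threshold c a zero c≤a+0 _ _ =
  sym (m≤n⇒m∸n≡0 (subst (c ≤_) (+-identityʳ a) c≤a+0))
sumRange-threshold {g} c a (suc l) c≤a+1+l ones zeros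
  with sumRange-threshold c (suc a) l (subst (c ≤_) (+-suc a l) c≤a+1+l)
         (λ r → ones r ∘ ≤-trans (n≤1+n a)) zeros
     | a <? c
... | rest | yes a<c = begin
  g a + sumRange g (suc a) l ≡⟨ cong₂ _+_ (ones a ≤-refl a<c) rest ⟩
  1 + (c ∸ suc a)            ≡⟨ sym (+-∸-assoc 1 a<c) ⟩
  c ∸ a                      ∎
  where open ≡-Reasoning
... | rest | no a≮c = begin
  g a + sumRange g (suc a) l ≡⟨ cong₂ _+_ (zeros a c≤a) rest ⟩
  c ∸ suc a                  ≡⟨ m≤n⇒m∸n≡0 (m≤n⇒m≤1+n c≤a) ⟩
  0                          ≡⟨ m≤n⇒m∸n≡0 c≤a ⟨
  c ∸ a                      ∎
  where
  open ≡-Reasoning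
  c≤a : c ≤ a
  c≤a = ≮⇒≥ a≮c

argmin : ∀ (g : ℕ → ℕ) {a} b → a ≤ b → ∃[ i ] (a ≤ i × i ≤ b × (∀ r → a ≤ r → r ≤ b → g i ≤ g r))
argmin g {a} b a≤b with m≤n⇒m<n∨m≡n a≤b
... | inj₂ refl = a , ≤-refl , ≤-refl , λ r a≤r r≤a → ≤-reflexive (cong g (≤-antisym a≤r r≤a))
argmin g {a} (suc b) _ | inj₁ a<1+b with argmin g b (s≤s⁻¹ a<1+b)
... | i , a≤i , i≤b , minimal with g i ≤? g (suc b)
...   | yes gi≤g[1+b] = i , a≤i , m≤n⇒m≤1+n i≤b , λ r a≤r r≤1+b →
        [ (λ r<1+b → minimal r a≤r (s≤s⁻¹ r<1+b))
        , (λ { refl → gi≤g[1+b] })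
        ]′ (m≤n⇒m<n∨m≡n r≤1+b)
...   | no  gi≰g[1+b] = suc b , <⇒≤ a<1+b , ≤-refl , λ r a≤r r≤1+b →
        [ (λ r<1+b → ≤-trans (<⇒≤ (≰⇒> gi≰g[1+b])) (minimal r a≤r (s≤s⁻¹ r<1+b)))
        , (λ { refl → ≤-refl })
        ]′ (m≤n⇒m<n∨m≡n r≤1+b)

map-range-pred : ∀ (S : ℕ → ℕ) a l → (∀ j → a ≤ j → j < a + l → S (suc j) ≡ j) →
  map S (range (suc a) l) ≡ range a l
map-range-pred S a zero    _        = refl
map-range-pred S a (suc l) S[1+j]≡j = cong₂ _∷_
  (S[1+j]≡j a ≤-refl (m<m+n a (s≤s z≤n)))
  (map-range-pred S (suc a) l λ j a<j j<1+a+l →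
    S[1+j]≡j j (<⇒≤ a<j) (subst (j <_) (sym (+-suc a l)) j<1+a+l))

map-range-antitone : ∀ (S : ℕ → ℕ) {a} → (∀ k → a ≤ k → S (suc k) ≤ S k) →
  ∀ l → Linked _≥_ (map S (range a l))
map-range-antitone S anti zero          = []
map-range-antitone S anti (suc zero)    = [-]
map-range-antitone S anti (suc (suc l)) =
  anti _ ≤-refl ∷ map-range-antitone S (λ k → anti k ∘ <⇒≤) (suc l)

map-range-bounded : ∀ (S : ℕ → ℕ) {a n} → S a ≤ n → (∀ k → a ≤ k → S (suc k) ≤ S k) →
  ∀ l → All (_≤ n) (map S (range a l))
map-range-bounded S Sa≤n anti zero    = []
map-range-bounded S Sa≤n anti (suc l) =
  Sa≤n ∷ map-range-bounded S (≤-trans (anti _ ≤-refl) Sa≤n) (λ k → anti k ∘ <⇒≤) l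

map-range-climbs-then-descends : ∀ (S : ℕ → ℕ) {n} M → n ≤ M →
  (∀ j → j ≤ n → S (suc j) ≡ j) → (∀ k → n < k → S (suc k) ≤ S k) →
  ∃[ as ] (map S (range 2 M) ≡ range 1 n ++ as × All (_≤ n) as × Linked _≥_ as)
map-range-climbs-then-descends S {n} M n≤M climbs descends =
  tail , split , map-range-bounded S S[2+n]≤n tail-antitone L , map-range-antitone S tail-antitone L
  where
  L : ℕ
  L = M ∸ n
  tail : List ℕ
  tail = map S (range (2 + n) L)
  tail-antitone : ∀ k → 2 + n ≤ k → S (suc k) ≤ S k
  tail-antitone k 2+n≤k = descends k (<⇒≤ 2+n≤k)
  S[2+n]≤n : S (2 + n) ≤ n
  S[2+n]≤n = ≤-trans (descends (suc n) ≤-refl) (≤-reflexive (climbs n ≤-refl))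
  split : map S (range 2 M) ≡ range 1 n ++ tail
  split = begin
    map S (range 2 M)                    ≡⟨ cong (map S ∘ range 2) (m+[n∸m]≡n n≤M) ⟨
    map S (range 2 (n + L))              ≡⟨ cong (map S) (range-++ 2 n L) ⟩
    map S (range 2 n ++ range (2 + n) L) ≡⟨ map-++ S (range 2 n) _ ⟩
    map S (range 2 n) ++ tail            ≡⟨ cong (_++ tail) (map-range-pred S 1 n λ j _ → climbs j ∘ s≤s⁻¹) ⟩
    range 1 n ++ tail                    ∎
    where open ≡-Reasoning

Crossing : (ℕ → ℕ) → ℕ → ℕ → Set
Crossing h k r = r < k × k ≤ h r

crossing? : ∀ h k r → Dec (Crossing h k r)
crossing? h k r = r <? k ×-dec k ≤? h r

crossing : (ℕ → ℕ) → ℕ → ℕ → ℕ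
crossing h k r = indicator (crossing? h k r)

crossings-below-min : ∀ h {j} l → j ≤ l → (∀ r → 1 ≤ r → r ≤ j → j < h r) →
  sumRange (crossing h (suc j)) 1 l ≡ j
crossings-below-min h {j} l j≤l above = sumRange-threshold (suc j) 1 l (s≤s j≤l) ones zeros
  where
  ones : ∀ r → 1 ≤ r → r < suc j → crossing h (suc j) r ≡ 1
  ones r 1≤r r<1+j = indicator-yes (crossing? h (suc j) r) (r<1+j , above r 1≤r (s≤s⁻¹ r<1+j))
  zeros : ∀ r → suc j ≤ r → crossing h (suc j) r ≡ 0
  zeros r 1+j≤r = indicator-no (crossing? h (suc j) r) λ (r<1+j , _) → <⇒≱ r<1+j 1+j≤r

crossings-antitone : ∀ h → (∀ r → 1 ≤ r → h (suc r) ≤ suc (h r)) →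
  ∀ {i k} → 1 ≤ i → i ≤ k → h i ≤ k →
  ∀ l → sumRange (crossing h (suc k)) 1 l ≤ sumRange (crossing h k) 1 l
crossings-antitone h step {i} {k} 1≤i i≤k hi≤k l = sumRange-skip-≤ i before at after l 1≤i
  where
  before : ∀ r → r < i → crossing h (suc k) r ≤ crossing h k r
  before r r<i = indicator-mono (crossing? h (suc k) r) (crossing? h k r)
    λ (_ , 1+k≤hr) → <-≤-trans r<i i≤k , <⇒≤ 1+k≤hr
  at : crossing h (suc k) i ≡ 0
  at = indicator-no (crossing? h (suc k) i) λ (_ , 1+k≤hi) → <⇒≱ 1+k≤hi hi≤k
  after : ∀ r → i ≤ r → crossing h (suc k) (suc r) ≤ crossing h k r
  after r i≤r = indicator-mono (crossing? h (suc k) (suc r)) (crossing? h k r)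
    λ (1+r<1+k , 1+k≤h[1+r]) →
      s≤s⁻¹ 1+r<1+k , s≤s⁻¹ (≤-trans 1+k≤h[1+r] (step r (≤-trans 1≤i i≤r)))

part-antitone : ∀ {λs} → Linked _≥_ λs → ∀ i → 1 ≤ i → part λs (suc i) ≤ part λs i
part-antitone {[]}        _         _             _ = z≤n
part-antitone {_ ∷ []}    _         (suc zero)    _ = z≤n
part-antitone {_ ∷ _ ∷ _} (x≥y ∷ _) (suc zero)    _ = x≥y
part-antitone {_ ∷ _}     lk        (suc (suc i)) _ = part-antitone (Linked.tail lk) (suc i) (s≤s z≤n)

part-≤-firstPart : ∀ {λs} → Linked _≥_ λs → ∀ i → part λs i ≤ firstPart λs
part-≤-firstPart {[]}    _  _             = z≤n
part-≤-firstPart {_ ∷ _} _  zero          = z≤n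
part-≤-firstPart {_ ∷ _} _  (suc zero)    = ≤-refl
part-≤-firstPart {_ ∷ _} lk (suc (suc i)) =
  ≤-trans (part-antitone lk (suc i) (s≤s z≤n)) (part-≤-firstPart lk (suc i))

part-≤-sideLength : ∀ {λs} → Linked _≥_ λs → ∀ i → part λs i ≤ sideLength λs
part-≤-sideLength lk i = ≤-trans (part-≤-firstPart lk i) (m≤m⊔n _ _)

lastDiag : List ℕ → ℕ → ℕ
lastDiag λs r = part λs r + r

lastDiag-step : ∀ {λs} → Linked _≥_ λs → ∀ r → 1 ≤ r → lastDiag λs (suc r) ≤ suc (lastDiag λs r)
lastDiag-step {λs} lk r 1≤r = begin
  part λs (suc r) + suc r   ≡⟨ +-suc _ r ⟩
  suc (part λs (suc r) + r) ≤⟨ s≤s (+-monoˡ-≤ r (part-antitone lk r 1≤r)) ⟩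
  suc (part λs r + r)       ∎
  where open ≤-Reasoning

lastDiag-≥2 : ∀ {x xs} → 1 ≤ x → ∀ r → 1 ≤ r → 2 ≤ lastDiag (x ∷ xs) r
lastDiag-≥2 1≤x (suc zero)    _ = +-monoˡ-≤ 1 1≤x
lastDiag-≥2 _   (suc (suc r)) _ = ≤-trans (s≤s (s≤s z≤n)) (m≤n+m (suc (suc r)) _)

ferrers-indicator : ∀ λs r {d} → 1 ≤ d → ferrers λs r d ≡ indicator (d ≤? part λs r)
ferrers-indicator λs r {suc d} _ = refl

-- The guard k ∸ r ≤ m of antiDiagSum never cuts off a cell, since λ_r ≤ m.
antiDiagSum-entry : ∀ {λs m k r} → part λs r ≤ m →
  (r<k? : Dec (r < k)) (k∸r≤m? : Dec (k ∸ r ≤ m)) →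
  (if does k∸r≤m? then (if does r<k? then ferrers λs r (k ∸ r) else 0) else 0)
    ≡ crossing (lastDiag λs) k r
antiDiagSum-entry {λs} {k = k} {r} _ (no r≮k) (yes _) =
  sym (indicator-no (crossing? (lastDiag λs) k r) (r≮k ∘ proj₁))
antiDiagSum-entry {λs} {k = k} {r} _ (no r≮k) (no _) =
  sym (indicator-no (crossing? (lastDiag λs) k r) (r≮k ∘ proj₁))
antiDiagSum-entry {λs} {k = k} {r} _ (yes r<k) (yes _) =
  trans (ferrers-indicator λs r (m<n⇒0<n∸m r<k))
    (indicator-cong (k ∸ r ≤? part λs r) (crossing? (lastDiag λs) k r)
      (λ k∸r≤λr → r<k , m∸n≤o⇒m≤o+n k r k∸r≤λr) (m≤o+n⇒m∸n≤o k r ∘ proj₂))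
antiDiagSum-entry {λs} {k = k} {r} λr≤m (yes r<k) (no k∸r≰m) =
  sym (indicator-no (crossing? (lastDiag λs) k r)
    λ (_ , k≤h) → k∸r≰m (≤-trans (m≤o+n⇒m∸n≤o k r k≤h) λr≤m))

antiDiagSum≡crossings : ∀ {λs} → Linked _≥_ λs → ∀ k →
  antiDiagSum λs k ≡ sumRange (crossing (lastDiag λs) k) 1 (sideLength λs)
antiDiagSum≡crossings {λs} lk k = cong sum (map-cong
  (λ r → antiDiagSum-entry {λs} {sideLength λs} {k}
           (part-≤-sideLength lk r) (r <? k) (k ∸ r ≤? sideLength λs))
  (range 1 (sideLength λs)))

antiDiagSum-climbs-then-descends : ∀ {x xs} → Linked _≥_ (x ∷ xs) → 1 ≤ x →
  ∃[ n ] (1 ≤ n × n ≤ sideLength (x ∷ xs)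
         × (∀ j → j ≤ n → antiDiagSum (x ∷ xs) (suc j) ≡ j)
         × (∀ k → n < k → antiDiagSum (x ∷ xs) (suc k) ≤ antiDiagSum (x ∷ xs) k))
antiDiagSum-climbs-then-descends {x} {xs} lk 1≤x
  with argmin (lastDiag (x ∷ xs)) (sideLength (x ∷ xs)) (≤-trans 1≤x (m≤m⊔n x _))
... | i , 1≤i , _ , minimal = n , 1≤n , n≤m , climbs , descends
  where
  λs : List ℕ
  λs = x ∷ xs
  m : ℕ
  m = sideLength λs
  h : ℕ → ℕ
  h = lastDiag λs
  n : ℕ
  n = h i ∸ 1
  1+n≡hi : suc n ≡ h i
  1+n≡hi = m+[n∸m]≡n (≤-trans (s≤s z≤n) (lastDiag-≥2 1≤x i 1≤i))
  1≤n : 1 ≤ n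
  1≤n = ∸-monoˡ-≤ 1 (lastDiag-≥2 1≤x i 1≤i)
  n≤m : n ≤ m
  n≤m = begin
    h i ∸ 1   ≤⟨ ∸-monoˡ-≤ 1 (minimal 1 ≤-refl (≤-trans 1≤x (m≤m⊔n x _))) ⟩
    x + 1 ∸ 1 ≡⟨ m+n∸n≡m x 1 ⟩
    x         ≤⟨ m≤m⊔n x _ ⟩
    m         ∎
    where open ≤-Reasoning
  n<h : ∀ r → 1 ≤ r → r ≤ m → n < h r
  n<h r 1≤r r≤m = subst (_≤ h r) (sym 1+n≡hi) (minimal r 1≤r r≤m)
  climbs : ∀ j → j ≤ n → antiDiagSum λs (suc j) ≡ j
  climbs j j≤n = trans (antiDiagSum≡crossings lk (suc j)) (crossings-below-min h m (≤-trans j≤n n≤m)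
    λ r 1≤r r≤j → ≤-<-trans j≤n (n<h r 1≤r (≤-trans r≤j (≤-trans j≤n n≤m))))
  descends : ∀ k → n < k → antiDiagSum λs (suc k) ≤ antiDiagSum λs k
  descends k n<k = begin
    antiDiagSum λs (suc k)            ≡⟨ antiDiagSum≡crossings lk (suc k) ⟩
    sumRange (crossing h (suc k)) 1 m ≤⟨ crossings-antitone h (lastDiag-step lk) 1≤i i≤k hi≤k m ⟩
    sumRange (crossing h k) 1 m       ≡⟨ antiDiagSum≡crossings lk k ⟨
    antiDiagSum λs k                  ∎
    where
    open ≤-Reasoning
    hi≤k : h i ≤ k
    hi≤k = subst (_≤ k) 1+n≡hi n<k
    i≤k : i ≤ k
    i≤k = ≤-trans (m≤n+m i _) hi≤k

lemma6p2 : (λs : List ℕ) → IsPartition λs → λs ≢ [] →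
    Σ ℕ (λ n → Σ (List ℕ) (λ as →
      (1 ≤ n) × (xray λs ≡ range 1 n ++ as) × All (λ a → a ≤ n) as × Linked _≥_ as))
lemma6p2 []       _               []≢[] = contradiction refl []≢[]
lemma6p2 (x ∷ xs) (lk , 1≤x ∷ _) _
  with n , 1≤n , n≤m , climbs , descends ← antiDiagSum-climbs-then-descends lk 1≤x
  with as , shape , bounded , linked ←
         map-range-climbs-then-descends (antiDiagSum (x ∷ xs)) _
           (≤-trans n≤m (m≤m+m∸1 (≤-trans 1≤n n≤m))) climbs descends
  = n , as , 1≤n , shape , bounded , linked
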